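{- Let $X$ be a type with an operator $\mathrm{int}:\mathcal P(X)\to\mathcal P(X)$ and let $s,c:\mathcal P(X)$. Then $\mathbf{Cpt}(s)\multimap\mathrm{cl}\,c\subseteq c\multimap\,!(c\subseteq c\boxtimes c)\multimap\mathbf{Cpt}(s\boxtimes c).$
   Context: Framework: constructive mathematics with affine logic as internal logic (classical linear logic with weakening but without contraction). Connectives: $\otimes$ (multiplicative conjunction, unit $\top$), $\mathbin{\mathrm{par}}$ (multiplicative disjunction, unit $\bot$), $\mathbin{\&}$ (additive conjunction), $\oplus$ (additive disjunction), involutive negation $\neg$, $\multimap$ (right associative), exponentials $!,?$; $\forall,\exists$ usual (additive) quantifiers; $\otimes,\mathbin{\&}$ bind tighter than $\mathbin{\mathrm{par}},\oplus,\multimap$. $\Omega$ is the impredicative type of propositions, $\mathcal P(X):=X\to\Omega$, $x\in s$ means $s(x)$, $x\notin s$ means $\neg s(x)$, $s\subseteq t:=\forall x,(x\in s\multimap x\in t)$, $s^{\mathsf c}:=\{x\mid x\notin s\}$, $s\boxtimes t:=\{x\mid x\in s\otimes x\in t\}$, $X$ also denotes $\{x\mid\top\}$. Closure: $\mathrm{cl}\,s:=(\mathrm{int}(s^{\mathsf c}))^{\mathsf c}$. Filter: $\mathbf{Fil}(\mathcal F):=\,!\big((\forall s,t,(s\in\mathcal F\multimap s\subseteq t\multimap t\in\mathcal F))\otimes X\in\mathcal F\otimes\forall s,t,(s\in\mathcal F\otimes t\in\mathcal F\multimap s\boxtimes t\in\mathcal F)\big)$ for $\mathcal F:\mathcal P(\mathcal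 P(X))$. Compactness: $\mathbf{Cpt}(s):=\forall\mathcal F:\mathcal P(\mathcal P(X)),\ \mathbf{Fil}(\mathcal F)\multimap s^{\mathsf c}\notin\mathcal F\multimap\exists x:X,\big(x\in s\otimes\,!\forall t:\mathcal P(X),(t\in\mathcal F\multimap x\in\mathrm{cl}\,t)\big)$. -}

module Defs where

-- Affine logic interpreted via Shulman's antithesis (Chu) translation:
-- an affine proposition is a pair (affirmation, refutation) of
-- intuitionistic types; the elements of the impredicative type Omega
-- additionally carry disjointness of the two components.
-- A closed affine formula is "true" iff its affirmation is inhabited.

open import Level using (Level; _⊔_; 0ℓ) renaming (suc to lsuc)
open import Data.Product using (Σ; _×_; _,_)
open import Data.Sum using (_⊎_)
open import Data.Unit.Polymorphic using (⊤)
open import Data.Empty.Polymorphic using (⊥)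
open import Data.Empty using () renaming (⊥ to ⊥₀)
open import Relation.Nullary using (¬_)

record Prp (ℓ : Level) : Set (lsuc ℓ) where
  constructor ⟨_∣_⟩
  field
    pos : Set ℓ
    neg : Set ℓ
open Prp public

private variable a b ℓ : Level

_⊗_ : Prp a → Prp b → Prp (a ⊔ b)
φ ⊗ ψ = ⟨ pos φ × pos ψ ∣ (pos φ → neg ψ) × (pos ψ → neg φ) ⟩

_⅋_ : Prp a → Prp b → Prp (a ⊔ b)
φ ⅋ ψ = ⟨ (neg φ → pos ψ) × (neg ψ → pos φ) ∣ neg φ × neg ψ ⟩

_&_ : Prp a → Prp b → Prp (a ⊔ b)
φ & ψ = ⟨ pos φ × pos ψ ∣ neg φ ⊎ neg ψ ⟩

_⊕_ : Prp a → Prp b → Prp (a ⊔ b)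
φ ⊕ ψ = ⟨ pos φ ⊎ pos ψ ∣ neg φ × neg ψ ⟩

∼_ : Prp a → Prp a
∼ φ = ⟨ neg φ ∣ pos φ ⟩

_⊸_ : Prp a → Prp b → Prp (a ⊔ b)
φ ⊸ ψ = (∼ φ) ⅋ ψ

!_ : Prp a → Prp a
! φ = ⟨ pos φ ∣ ¬ pos φ ⟩

¿_ : Prp a → Prp a
¿ φ = ⟨ ¬ neg φ ∣ neg φ ⟩

𝟙 : Prp a
𝟙 = ⟨ ⊤ ∣ ⊥ ⟩

∀' : (A : Set a) → (A → Prp ℓ) → Prp (a ⊔ ℓ)
∀' A φ = ⟨ ((x : A) → pos (φ x)) ∣ Σ A (λ x → neg (φ x)) ⟩

∃' : (A : Set a) → (A → Prp ℓ) → Prp (a ⊔ ℓ)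
∃' A φ = ⟨ Σ A (λ x → pos (φ x)) ∣ ((x : A) → neg (φ x)) ⟩

infixr 9 ∼_ !_ ¿_
infixr 7 _⊗_ _&_
infixr 6 _⅋_ _⊕_
infixr 5 _⊸_

record Ω : Set₁ where
  constructor mkΩ
  field
    prop : Prp 0ℓ
    disj : pos prop → neg prop → ⊥₀
open Ω public

𝒫 : Set a → Set (a ⊔ lsuc 0ℓ)
𝒫 X = X → Ω

_∈_ : {A : Set a} → A → (A → Ω) → Prp 0ℓ
x ∈ s = prop (s x)

_∉_ : {A : Set a} → A → (A → Ω) → Prp 0ℓ
x ∉ s = ∼ (x ∈ s)

infix 8 _∈_ _∉_

module _ {X : Set} where

  _ᶜ : 𝒫 X → 𝒫 X
  (s ᶜ) x = mkΩ (x ∉ s) (λ n p → disj (s x) p n)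

  _⊠_ : 𝒫 X → 𝒫 X → 𝒫 X
  (s ⊠ t) x = mkΩ (x ∈ s ⊗ x ∈ t) (λ { (p , q) (f , g) → disj (t x) q (f p) })

  full : 𝒫 X
  full x = mkΩ 𝟙 (λ _ ())

  _⊆_ : 𝒫 X → 𝒫 X → Prp 0ℓ
  s ⊆ t = ∀' X (λ x → x ∈ s ⊸ x ∈ t)

  infixl 10 _ᶜ
  infixl 9 _⊠_
  infix 8 _⊆_

  module Topology (int : 𝒫 X → 𝒫 X) where

    cl : 𝒫 X → 𝒫 X
    cl s = (int (s ᶜ)) ᶜ

    Fil : (𝒫 X → Ω) → Prp (lsuc 0ℓ)
    Fil F = ! ( ∀' (𝒫 X) (λ s → ∀' (𝒫 X) (λ t → s ∈ F ⊸ s ⊆ t ⊸ t ∈ F))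
              ⊗ full ∈ F
              ⊗ ∀' (𝒫 X) (λ s → ∀' (𝒫 X) (λ t → s ∈ F ⊗ t ∈ F ⊸ (s ⊠ t) ∈ F)) )

    Cpt : 𝒫 X → Prp (lsuc 0ℓ)
    Cpt s = ∀' (𝒫 X → Ω) (λ F →
              Fil F ⊸ (s ᶜ) ∉ F ⊸
                ∃' X (λ x → x ∈ s ⊗ ! ∀' (𝒫 X) (λ t → t ∈ F ⊸ x ∈ cl t)))

-- Extensionality of an operator on subsets (a theorem of the internal
-- higher-order logic, made explicit for the Agda model): subsets whose
-- membership propositions are pointwise equivalent (both affirmation and
-- refutation) are sent to pointwise equivalent subsets.
_≅_ : {X : Set} → 𝒫 X → 𝒫 X → Set
_≅_ {X} s t = (x : X) →
  ((pos (x ∈ s) → pos (x ∈ t)) × (pos (x ∈ t) → pos (x ∈ s))) ×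
  ((neg (x ∈ s) → neg (x ∈ t)) × (neg (x ∈ t) → neg (x ∈ s)))

Extensional : {X : Set} → (𝒫 X → 𝒫 X) → Set₁
Extensional {X} f = (s t : 𝒫 X) → s ≅ t → f s ≅ f t

{-# OPTIONS --safe #-}
module Submission where

-- Adjoin c to a filter F: the sets t with c ⊸ t ∈ F form a filter (closure
-- under ⊠ uses c twice, whence c ⊆ c ⊠ c), and it avoids sᶜ when F avoids
-- (s ⊠ c)ᶜ. A cluster point in s of the new filter clusters F and lies in
-- cl c, hence in c when cl c ⊆ c: it is a cluster point of F in s ⊠ c.
-- The refutation halves of the connectives run the argument backwards: a
-- filter refuting compactness of s ⊠ c yields one refuting compactness of s
-- or, if s is compact, a point of cl c refuting membership in c.

open import Defs
open import Data.Empty using (⊥; ⊥-elim)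
open import Data.Product using (_×_; _,_; proj₁; proj₂)
open import Level using (Level; 0ℓ) renaming (suc to lsuc)

private variable
  ℓ₁ ℓ₂ ℓ₃ ℓ₄ ℓ₅ : Level
  φ : Prp ℓ₁
  φ′ : Prp ℓ₂
  ψ : Prp ℓ₃
  ψ′ : Prp ℓ₄
  χ : Prp ℓ₅

Disjoint : Prp ℓ₁ → Set ℓ₁
Disjoint φ = pos φ → neg φ → ⊥

⊸-refl : pos (φ ⊸ φ)
⊸-refl = (λ p → p) , (λ n → n)

⊸-trans : pos (φ ⊸ ψ) → pos (ψ ⊸ χ) → pos (φ ⊸ χ)
⊸-trans (f , f⁻) (g , g⁻) = (λ p → g (f p)) , (λ n → f⁻ (g⁻ n))

⊸-contrapose : pos (φ ⊸ ψ) → pos (∼ ψ ⊸ ∼ φ)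
⊸-contrapose (f , f⁻) = f⁻ , f

⊸-mono : pos (φ ⊸ φ′) → pos (ψ ⊸ ψ′) → pos ((φ′ ⊸ ψ) ⊸ (φ ⊸ ψ′))
⊸-mono (f , f⁻) (g , g⁻) =
    (λ { (h , h⁻) → (λ p → g (h (f p))) , (λ n → f⁻ (h⁻ (g⁻ n))) })
  , (λ { (p , n) → f p , g⁻ n })

⊸-curry : pos (φ ⊗ ψ ⊸ χ) → pos (φ ⊸ ψ ⊸ χ)
⊸-curry (f , f⁻) =
    (λ p → (λ q → f (p , q)) , (λ n → proj₁ (f⁻ n) p))
  , (λ { (q , n) → proj₂ (f⁻ n) q })

⊸-apply₂ : pos (φ ⊸ ψ ⊸ χ) → pos ψ → pos (φ ⊸ χ)
⊸-apply₂ (f , f⁻) q = (λ p → proj₁ (f p) q) , (λ n → f⁻ (q , n))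

!-intro₂ : Disjoint χ → (pos ψ′ → pos (φ ⊸ ψ ⊸ χ)) → pos (φ ⊸ ψ ⊸ ! ψ′ ⊸ χ)
!-intro₂ disj h =
    (λ p → (λ q → (λ d → proj₁ (proj₁ (h d) p) q)
                , (λ n d → disj (proj₁ (proj₁ (h d) p) q) n))
         , (λ { (d , n) → proj₂ (proj₁ (h d) p) n }))
  , (λ { (q , d , n) → proj₂ (h d) (q , n) })

∃-⊗-∀-⊸ : {A : Set ℓ₁} {φ : A → Prp ℓ₂} {ψ : A → Prp ℓ₃} {χ : A → Prp ℓ₄} →
          (∀ x → pos (φ x ⊗ ψ x ⊸ χ x)) → pos (∃' A φ ⊗ ∀' A ψ ⊸ ∃' A χ)
∃-⊗-∀-⊸ h =
    (λ { ((x , p) , q) → x , proj₁ (h x) (p , q x) })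
  , (λ n → (λ { (x , p) → x , proj₁ (proj₂ (h x) (n x)) p })
         , (λ q x → proj₂ (proj₂ (h x) (n x)) (q x)))

module _ {X : Set} where

  _⇒_ : 𝒫 X → 𝒫 X → 𝒫 X
  (a ⇒ t) x = mkΩ (x ∈ a ⊸ x ∈ t) (λ { (f , _) (p , n) → disj (t x) (f p) n })

  infixr 9 _⇒_

  ⇒-monoʳ-⊆ : {a b c : 𝒫 X} → pos (a ⊆ b ⊸ (c ⇒ a) ⊆ (c ⇒ b))
  ⇒-monoʳ-⊆ =
      (λ a⊆b x → (λ { (f , f⁻) → (λ p → proj₁ (a⊆b x) (f p)) , (λ n → f⁻ (proj₂ (a⊆b x) n)) })
               , (λ { (p , n) → p , proj₂ (a⊆b x) n }))
    , (λ { (x , (f , _) , (p , n)) → x , f p , n })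

  t⊆c⇒t : (c t : 𝒫 X) → pos (t ⊆ c ⇒ t)
  t⊆c⇒t c t x = (λ p → (λ _ → p) , (λ n → ⊥-elim (disj (t x) p n))) , (λ { (_ , n) → n })

  full⊆t⇒t : (t : 𝒫 X) → pos (full ⊆ t ⇒ t)
  full⊆t⇒t t x = (λ _ → ⊸-refl) , (λ { (p , n) → ⊥-elim (disj (t x) p n) })

  c⇒sᶜ⊆[s⊠c]ᶜ : (s c : 𝒫 X) → pos ((c ⇒ s ᶜ) ⊆ (s ⊠ c) ᶜ)
  c⇒sᶜ⊆[s⊠c]ᶜ s c x = (λ { (f , f⁻) → f⁻ , f }) , (λ { (p , q) → q , p })

  ⇒-distrib-⊠ : {a b c : 𝒫 X} → pos (c ⊆ c ⊠ c) → pos ((c ⇒ a) ⊠ (c ⇒ b) ⊆ c ⇒ (a ⊠ b))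
  ⇒-distrib-⊠ c⊆c⊠c x =
      (λ { ((f , f⁻) , (g , g⁻)) →
           (λ p → f p , g p)
         , (λ { (a→¬b , _) → proj₂ (c⊆c⊠c x) ((λ p → g⁻ (a→¬b (f p))) , (λ p → g⁻ (a→¬b (f p)))) }) })
    , (λ { (p , ¬a , ¬b) → (λ { (f , _) → p , ¬a (f p) }) , (λ { (g , _) → p , ¬b (g p) }) })

  adjoin : 𝒫 X → (𝒫 X → Ω) → (𝒫 X → Ω)
  adjoin c F t = F (c ⇒ t)

  module _ (int : 𝒫 X → 𝒫 X) where
    open Topology int

    clusters : (𝒫 X → Ω) → X → Prp (lsuc 0ℓ)
    clusters F x = ∀' (𝒫 X) (λ t → t ∈ F ⊸ x ∈ cl t)

    clusterIn : (𝒫 X → Ω) → 𝒫 X → Prp (lsuc 0ℓ)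
    clusterIn F a = ∃' X (λ x → x ∈ a ⊗ ! clusters F x)

    Cpt-disjoint : {s : 𝒫 X} → Disjoint (Cpt s)
    Cpt-disjoint C (F , fil , s∉F , ¬cluster) with proj₁ (proj₁ (C F) fil) s∉F
    ... | x , p , P = proj₁ (¬cluster x) p P

    Cpt-transfer : {s s′ : 𝒫 X} (Φ : (𝒫 X → Ω) → (𝒫 X → Ω)) →
      (∀ {F} → pos (Fil F) → pos (Fil (Φ F))) →
      (∀ {F} → pos (Fil F) → pos (s′ ᶜ ∉ F ⊸ s ᶜ ∉ Φ F)) →
      (∀ {F} → pos (Fil F) → pos (clusterIn (Φ F) s ⊗ ψ ⊸ clusterIn F s′)) →
      pos (Cpt s ⊗ ψ ⊸ Cpt s′)
    Cpt-transfer {ψ = ψ} {s} {s′} Φ fil-Φ avoid-Φ cluster-Φ =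
        (λ { (C , q) F → (λ fil → proj₁ (transport q fil) (proj₁ (C (Φ F)) (fil-Φ fil)))
                       , (λ n fil → proj₂ (C (Φ F)) (proj₂ (transport q fil) n) (fil-Φ fil)) })
      , (λ { (F , fil , s′∉F , ¬cluster) →
               (λ C → proj₁ (proj₂ (cluster-Φ fil) ¬cluster)
                        (proj₁ (proj₁ (C (Φ F)) (fil-Φ fil)) (proj₁ (avoid-Φ fil) s′∉F)))
             , (λ q → Φ F , fil-Φ fil , proj₂ (transport q fil) (s′∉F , ¬cluster)) })
      where
        transport : pos ψ → ∀ {F} → pos (Fil F) →
                    pos ((s ᶜ ∉ Φ F ⊸ clusterIn (Φ F) s) ⊸ (s′ ᶜ ∉ F ⊸ clusterIn F s′))
        transport q fil = ⊸-mono (avoid-Φ fil) (⊸-apply₂ (⊸-curry (cluster-Φ fil)) q)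

    module _ {F : 𝒫 X → Ω} (fil : pos (Fil F)) where

      Fil-upward : (a b : 𝒫 X) → pos (a ⊆ b) → pos (a ∈ F ⊸ b ∈ F)
      Fil-upward a b = ⊸-apply₂ (proj₁ fil a b)

      full∈F : pos (full ∈ F)
      full∈F = proj₁ (proj₂ fil)

      Fil-⊠ : (a b : 𝒫 X) → pos (a ∈ F ⊗ b ∈ F ⊸ (a ⊠ b) ∈ F)
      Fil-⊠ = proj₂ (proj₂ fil)

      module _ {c : 𝒫 X} where

        Fil-adjoin : pos (c ⊆ c ⊠ c) → pos (Fil (adjoin c F))
        Fil-adjoin c⊆c⊠c =
            (λ a b → ⊸-trans (proj₁ fil (c ⇒ a) (c ⇒ b)) (⊸-mono (⇒-monoʳ-⊆ {a} {b} {c}) ⊸-refl))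
          , proj₁ (Fil-upward full (c ⇒ full) (t⊆c⇒t c full)) full∈F
          , (λ a b → ⊸-trans (Fil-⊠ (c ⇒ a) (c ⇒ b))
                              (Fil-upward _ (c ⇒ (a ⊠ b)) (⇒-distrib-⊠ {a} {b} {c} c⊆c⊠c)))

        adjoin-avoids : {s : 𝒫 X} → pos ((s ⊠ c) ᶜ ∉ F ⊸ s ᶜ ∉ adjoin c F)
        adjoin-avoids {s} = ⊸-contrapose (Fil-upward (c ⇒ s ᶜ) ((s ⊠ c) ᶜ) (c⇒sᶜ⊆[s⊠c]ᶜ s c))

        clusters-adjoin⇒clusters : {x : X} → pos (clusters (adjoin c F) x) → pos (clusters F x)
        clusters-adjoin⇒clusters P t = ⊸-trans (Fil-upward t (c ⇒ t) (t⊆c⇒t c t)) (P t)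

        clusters-adjoin⇒∈cl : {x : X} → pos (clusters (adjoin c F) x) → pos (x ∈ cl c)
        clusters-adjoin⇒∈cl P = proj₁ (P c) (proj₁ (Fil-upward full (c ⇒ c) (full⊆t⇒t c)) full∈F)

        clusterIn-adjoin : {s : 𝒫 X} →
                           pos (clusterIn (adjoin c F) s ⊗ cl c ⊆ c ⊸ clusterIn F (s ⊠ c))
        clusterIn-adjoin {s} = ∃-⊗-∀-⊸ pointwise
          where
            pointwise : ∀ x → pos ((x ∈ s ⊗ ! clusters (adjoin c F) x) ⊗ (x ∈ cl c ⊸ x ∈ c) ⊸
                                   x ∈ s ⊠ c ⊗ ! clusters F x)
            pointwise x =
                (λ { ((p , P) , (f , _)) →
                       (p , f (clusters-adjoin⇒∈cl P)) , clusters-adjoin⇒clusters P })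
              , (λ { (¬cluster , ¬s⊠c) →
                       (λ { (p , P) →
                              clusters-adjoin⇒∈cl P , proj₁ (¬s⊠c (clusters-adjoin⇒clusters P)) p })
                     , (λ { (f , _) →
                              (λ p P → ¬cluster (p , f (clusters-adjoin⇒∈cl P))
                                                (clusters-adjoin⇒clusters P))
                            , (λ P → proj₂ (¬s⊠c (clusters-adjoin⇒clusters P))
                                           (f (clusters-adjoin⇒∈cl P))) }) })

proposition18 : (X : Set) (int : 𝒫 X → 𝒫 X) → Extensional int → (s c : 𝒫 X) → pos (Topology.Cpt int s ⊸ Topology.cl int c ⊆ c ⊸ ! (c ⊆ c ⊠ c) ⊸ Topology.Cpt int (s ⊠ c))
proposition18 X int _ s c =
  !-intro₂ {ψ′ = c ⊆ c ⊠ c} (Cpt-disjoint int) λ c⊆c⊠c →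
  ⊸-curry (Cpt-transfer int {s = s} {s′ = s ⊠ c} (adjoin c)
            (λ {F} fil → Fil-adjoin int {F} fil {c} c⊆c⊠c)
            (λ {F} fil → adjoin-avoids int {F} fil {c} {s})
            (λ {F} fil → clusterIn-adjoin int {F} fil {c} {s}))
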